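{- Let $G$ be a group acting transitively on a finite set $X$, and let $A\subseteq X$ be a kaleidoscopical configuration with kaleidoscopical coloring $\chi:X\to\{0,1,\dots,k-1\}$ (a surjective map such that $\chi|_{gA}$ is a bijection onto $\{0,\dots,k-1\}$ for every $g\in G$). Then $|\chi^{ -1}(0)|=|\chi^{ -1}(1)|=\dots=|\chi^{ -1}(k-1)|$ and $|X|=|A|\cdot|\chi^{ -1}(0)|$.
   Context: A subset $A$ of a $G$-space $X$ is a kaleidoscopical configuration if there is a map $\chi$ from $X$ to a set $C$ such that $\chi|_{gA}:gA\to C$ is bijective for all $g\in G$. -}

module Defs where

open import Level using (Level; _⊔_)
open import Data.Nat using (ℕ)
open import Data.Fin using (Fin; _≟_)
open import Data.Fin.Subset using (Subset; _∈_)
open import Data.Vec using (count; allFin)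
open import Data.Product using (Σ; ∃; _×_; _,_)
open import Relation.Binary.PropositionalEquality using (_≡_)
open import Algebra.Bundles using (Group)

record Action {c ℓ : Level} (G : Group c ℓ) (n : ℕ) : Set (c ⊔ ℓ) where
  open Group G
  field
    act      : Carrier → Fin n → Fin n
    act-cong : ∀ {g h} → g ≈ h → ∀ x → act g x ≡ act h x
    act-ε    : ∀ x → act ε x ≡ x
    act-∙    : ∀ g h x → act (g ∙ h) x ≡ act g (act h x)

module _ {c ℓ : Level} {G : Group c ℓ} {n : ℕ} (α : Action G n) where
  open Group G
  open Action α

  Transitive : Set (c)
  Transitive = ∀ x y → Σ Carrier λ g → act g x ≡ y

  _∈[_·_] : Fin n → Carrier → Subset n → Set
  x ∈[ g · A ] = Σ (Fin n) λ a → a ∈ A × act g a ≡ x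

  record KaleidoscopicalColoring (A : Subset n) (k : ℕ) (χ : Fin n → Fin k) : Set c where
    field
      surjective : ∀ i → Σ (Fin n) λ x → χ x ≡ i
      restr-injective : ∀ g x y → x ∈[ g · A ] → y ∈[ g · A ] → χ x ≡ χ y → x ≡ y
      restr-surjective : ∀ g i → Σ (Fin n) λ x → x ∈[ g · A ] × χ x ≡ i

fiberSize : {n k : ℕ} → (Fin n → Fin k) → Fin k → ℕ
fiberSize {n} χ i = count (λ x → χ x ≟ i) (allFin n)

-- Double counting. Finitely many subsets of X are translates of A, and each of them
-- has exactly one point of every colour. Since the action is transitive, every point of
-- X lies in the same number c > 0 of distinct translates. Counting the incidences
-- (point, translate) gives n c = k T, and counting those in the colour class χ⁻¹(i)
-- gives |χ⁻¹(i)| c = T, where T is the number of translates. Hence n = k |χ⁻¹(i)|.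
-- The group may be infinite, so membership in the set of translates is not decidable;
-- but the conclusion is a decidable equation, so such a decision may be assumed.
module Submission where

open import Defs
open import Level using (Level)
open import Data.Nat using (ℕ; zero; suc; _+_; _*_; _^_; _≤_; _<_; NonZero; >-nonZero)
open import Data.Nat.Properties
  using (+-*-semiring; *-commutativeSemigroup; *-identityˡ; *-identityʳ; *-zeroʳ; *-assoc;
         *-cancelʳ-≡; *-cancelˡ-≡; m≤m+n; m≤n+m; ≤-trans)
  renaming (_≟_ to _≟ℕ_)
open import Data.Fin using (Fin; zero; suc; _≟_; funToFin; finToFun; combine)
open import Data.Fin.Properties
  using (2↔Bool; nonZeroIndex; suc-injective; finToFun-funToFin; funToFin-finToFin)
open import Data.Fin.Permutation using (Permutation; permutation)
open import Data.Fin.Subset using (Subset; ∣_∣; _∈_)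
open import Data.Bool using (Bool; true; false) renaming (_≟_ to _≟ᵇ_)
open import Data.Vec using (Vec; []; _∷_; lookup; count; allFin)
open import Data.Vec.Properties using (lookup-allFin; []=⇒lookup; lookup⇒[]=)
open import Data.Product using (Σ; _×_; _,_)
open import Data.Empty using (⊥-elim)
open import Function using (_∘_; Inverse; mk⇔)
open import Relation.Unary using (Pred; Decidable)
open import Relation.Nullary using (Dec; does; yes; no; ¬_)
open import Relation.Nullary.Decidable using (dec-true; dec-false; does-⇔; decidable-stable)
open import Relation.Nullary.Decidable.Core using (¬¬-excluded-middle)
open import Relation.Binary.PropositionalEquality
  using (_≡_; _≢_; _≗_; refl; sym; trans; cong; cong₂; subst; module ≡-Reasoning)
open import Algebra.Bundles using (Group)
import Algebra.Properties.Group as GroupProperties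
open import Algebra.Properties.CommutativeSemigroup *-commutativeSemigroup using (x∙yz≈y∙xz)
open import Algebra.Properties.Semiring.Sum +-*-semiring
  using (sum; sum-cong-≗; ∑-comm; ∑-permute; *-distribˡ-sum; *-distribʳ-sum)

open ≡-Reasoning

𝟙 : Bool → ℕ
𝟙 false = 0
𝟙 true  = 1

𝟙*≡𝟙 : ∀ {p} {P : Set p} (P? : Dec P) {x : ℕ} → (P → x ≡ 1) → 𝟙 (does P?) * x ≡ 𝟙 (does P?)
𝟙*≡𝟙 (yes p) x≡1 = cong (1 *_) (x≡1 p)
𝟙*≡𝟙 (no _)  _   = refl

sum-const : ∀ {n} (f : Fin n → ℕ) {c : ℕ} → (∀ y → f y ≡ c) → sum f ≡ n * c
sum-const {zero}  f f≡c = refl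
sum-const {suc n} f f≡c = cong₂ _+_ (f≡c zero) (sum-const (f ∘ suc) (f≡c ∘ suc))

sum-unique : ∀ {n} (f : Fin n → ℕ) (y₀ : Fin n) →
             f y₀ ≡ 1 → (∀ y → y ≢ y₀ → f y ≡ 0) → sum f ≡ 1
sum-unique {suc n} f zero fy₀≡1 others =
  cong₂ _+_ fy₀≡1 (trans (sum-const (f ∘ suc) (λ y → others (suc y) λ ())) (*-zeroʳ n))
sum-unique {suc n} f (suc y₀) fy₀≡1 others =
  cong₂ _+_ (others zero λ ())
            (sum-unique (f ∘ suc) y₀ fy₀≡1 (λ y y≢y₀ → others (suc y) (y≢y₀ ∘ suc-injective)))

≤-sum : ∀ {n} (f : Fin n → ℕ) y → f y ≤ sum f
≤-sum f zero    = m≤m+n (f zero) _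
≤-sum f (suc y) = ≤-trans (≤-sum (f ∘ suc) y) (m≤n+m _ (f zero))

count≡sum : ∀ {a p n} {A : Set a} {P : Pred A p} (P? : Decidable P) (xs : Vec A n) →
            count P? xs ≡ sum (λ y → 𝟙 (does (P? (lookup xs y))))
count≡sum P? []       = refl
count≡sum P? (x ∷ xs) with does (P? x)
... | true  = cong suc (count≡sum P? xs)
... | false = count≡sum P? xs

¬¬-Decidable : ∀ {p N} (P : Fin N → Set p) → ¬ ¬ (∀ t → Dec (P t))
¬¬-Decidable {N = zero}  P ¬dec = ¬dec λ ()
¬¬-Decidable {N = suc N} P ¬dec = ¬¬-excluded-middle λ P₀? →
  ¬¬-Decidable (P ∘ suc) λ P? → ¬dec λ { zero → P₀? ; (suc t) → P? t }

funToFin-cong : ∀ {m n} {f g : Fin m → Fin n} → f ≗ g → funToFin f ≡ funToFin g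
funToFin-cong {zero}  f≗g = refl
funToFin-cong {suc m} f≗g = cong₂ combine (f≗g zero) (funToFin-cong (f≗g ∘ suc))

module _ {n k : ℕ} (χ : Fin n → Fin k) where

  fibre : Fin k → Fin n → ℕ
  fibre i y = 𝟙 (does (χ y ≟ i))

  Balanced : (Fin n → ℕ) → ℕ → Set
  Balanced S r = ∀ i → sum (λ y → fibre i y * S y) ≡ r

  fiberSize≡∑fibre : ∀ i → fiberSize χ i ≡ sum (fibre i)
  fiberSize≡∑fibre i = trans (count≡sum (λ x → χ x ≟ i) (allFin n))
    (sum-cong-≗ λ y → cong (λ x → 𝟙 (does (χ x ≟ i))) (lookup-allFin y))

  ∑fibre≡1 : ∀ y → sum (λ i → fibre i y) ≡ 1
  ∑fibre≡1 y = sum-unique _ (χ y) (cong 𝟙 (dec-true (χ y ≟ χ y) refl))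
    λ i i≢χy → cong 𝟙 (dec-false (χ y ≟ i) (i≢χy ∘ sym))

  sum≡∑fibres : ∀ S → sum S ≡ sum (λ i → sum (λ y → fibre i y * S y))
  sum≡∑fibres S = begin
    sum S                                    ≡⟨ sum-cong-≗ (λ y → trans (cong (_* S y) (∑fibre≡1 y)) (*-identityˡ (S y))) ⟨
    sum (λ y → sum (λ i → fibre i y) * S y)  ≡⟨ sum-cong-≗ (λ y → *-distribʳ-sum (S y) (λ i → fibre i y)) ⟩
    sum (λ y → sum (λ i → fibre i y * S y))  ≡⟨ ∑-comm (λ y i → fibre i y * S y) ⟩
    sum (λ i → sum (λ y → fibre i y * S y))  ∎

  balanced⇒sum≡k*r : ∀ S {r} → Balanced S r → sum S ≡ k * r
  balanced⇒sum≡k*r S balanced = trans (sum≡∑fibres S) (sum-const _ balanced)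

  -- Row t of M is the t-th member of a weighted family of subsets, c the covering multiplicity.
  uniformCover⇒n≡k*fiberSize : ∀ {N} (M : Fin N → Fin n → ℕ) (w : Fin N → ℕ) →
    (∀ t → Balanced (M t) (w t)) →
    (c : ℕ) .{{_ : NonZero c}} → (∀ y → sum (λ t → M t y) ≡ c) →
    ∀ i → n ≡ k * fiberSize χ i
  uniformCover⇒n≡k*fiberSize M w rows c columns i = *-cancelʳ-≡ n (k * fiberSize χ i) c (begin
    n * c                    ≡⟨ incidences ⟩
    k * sum w                ≡⟨ cong (k *_) incidencesInFibre ⟨
    k * (fiberSize χ i * c)  ≡⟨ *-assoc k (fiberSize χ i) c ⟨
    k * fiberSize χ i * c    ∎)
    where
    incidences : n * c ≡ k * sum w
    incidences = begin
      n * c                           ≡⟨ sum-const _ columns ⟨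
      sum (λ y → sum (λ t → M t y))   ≡⟨ ∑-comm (λ y t → M t y) ⟩
      sum (λ t → sum (M t))           ≡⟨ sum-cong-≗ (λ t → balanced⇒sum≡k*r (M t) (rows t)) ⟩
      sum (λ t → k * w t)             ≡⟨ *-distribˡ-sum k w ⟨
      k * sum w                       ∎

    incidencesInFibre : fiberSize χ i * c ≡ sum w
    incidencesInFibre = begin
      fiberSize χ i * c                          ≡⟨ cong (_* c) (fiberSize≡∑fibre i) ⟩
      sum (fibre i) * c                          ≡⟨ *-distribʳ-sum c (fibre i) ⟩
      sum (λ y → fibre i y * c)                  ≡⟨ sum-cong-≗ (λ y → cong (fibre i y *_) (columns y)) ⟨
      sum (λ y → fibre i y * sum (λ t → M t y))  ≡⟨ sum-cong-≗ (λ y → *-distribˡ-sum (fibre i y) (λ t → M t y)) ⟩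
      sum (λ y → sum (λ t → fibre i y * M t y))  ≡⟨ ∑-comm (λ y t → fibre i y * M t y) ⟩
      sum (λ t → sum (λ y → fibre i y * M t y))  ≡⟨ sum-cong-≗ (λ t → rows t i) ⟩
      sum w                                      ∎

-- Subsets of Fin n, enumerated as Fin (2 ^ n) so that one can sum over all of them.
Code : ℕ → Set
Code n = Fin (2 ^ n)

module _ {n : ℕ} where
  open Inverse 2↔Bool using (to; from; strictlyInverseˡ; strictlyInverseʳ)

  decode : Code n → Fin n → Bool
  decode t = to ∘ finToFun t

  encode : (Fin n → Bool) → Code n
  encode S = funToFin (from ∘ S)

  decode-encode : ∀ S → decode (encode S) ≗ S
  decode-encode S y = trans (cong to (finToFun-funToFin (from ∘ S) y)) (strictlyInverseˡ (S y))

  decode-injective : ∀ {t u} → decode t ≗ decode u → t ≡ u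
  decode-injective {t} {u} t≗u = begin
    t                        ≡⟨ funToFin-finToFin {n} {2} t ⟨
    funToFin (finToFun {2} {n} t)    ≡⟨ funToFin-cong finToFun-t≗u ⟩
    funToFin (finToFun {2} {n} u)    ≡⟨ funToFin-finToFin {n} {2} u ⟩
    u                        ∎
    where
    finToFun-t≗u : finToFun {2} t ≗ finToFun u
    finToFun-t≗u y = begin
      finToFun t y               ≡⟨ strictlyInverseʳ (finToFun t y) ⟨
      from (decode t y)          ≡⟨ cong from (t≗u y) ⟩
      from (decode u y)          ≡⟨ strictlyInverseʳ (finToFun u y) ⟩
      finToFun u y               ∎

module _ {c ℓ : Level} {G : Group c ℓ} {n : ℕ} (α : Action G n) where
  open Group G using (Carrier; _∙_; ε; _⁻¹; inverseˡ; inverseʳ)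
  open GroupProperties G using (ε⁻¹≈ε; ⁻¹-anti-homo-∙)
  open Action α

  act-inverseˡ : ∀ g x → act (g ⁻¹) (act g x) ≡ x
  act-inverseˡ g x = trans (sym (act-∙ (g ⁻¹) g x)) (trans (act-cong (inverseˡ g) x) (act-ε x))

  act-inverseʳ : ∀ g x → act g (act (g ⁻¹) x) ≡ x
  act-inverseʳ g x = trans (sym (act-∙ g (g ⁻¹) x)) (trans (act-cong (inverseʳ g) x) (act-ε x))

  act-ε⁻¹ : ∀ x → act (ε ⁻¹) x ≡ x
  act-ε⁻¹ x = trans (act-cong ε⁻¹≈ε x) (act-ε x)

  act-⁻¹-∙ : ∀ s g x → act ((s ∙ g) ⁻¹) x ≡ act (g ⁻¹) (act (s ⁻¹) x)
  act-⁻¹-∙ s g x = trans (act-cong (⁻¹-anti-homo-∙ s g) x) (act-∙ (g ⁻¹) (s ⁻¹) x)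

  shift : Carrier → Code n → Code n
  shift s t = encode (decode t ∘ act (s ⁻¹))

  decode-shift : ∀ s t → decode (shift s t) ≗ decode t ∘ act (s ⁻¹)
  decode-shift s t = decode-encode _

  shift⁻¹-shift : ∀ s t → shift (s ⁻¹) (shift s t) ≡ t
  shift⁻¹-shift s t = decode-injective λ y →
    trans (decode-shift (s ⁻¹) (shift s t) y)
          (trans (decode-shift s t _) (cong (decode t) (act-inverseʳ (s ⁻¹) y)))

  shift-shift⁻¹ : ∀ s t → shift s (shift (s ⁻¹) t) ≡ t
  shift-shift⁻¹ s t = decode-injective λ y →
    trans (decode-shift s (shift (s ⁻¹) t) y)
          (trans (decode-shift (s ⁻¹) t _) (cong (decode t) (act-inverseˡ (s ⁻¹) y)))

  shift-permutation : Carrier → Permutation (2 ^ n) (2 ^ n)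
  shift-permutation s = permutation (shift s) (shift (s ⁻¹)) (shift-shift⁻¹ s) (shift⁻¹-shift s)

module Kaleidoscopic {c ℓ : Level} {G : Group c ℓ} {n : ℕ} (α : Action G n)
  {A : Subset n} {k : ℕ} {χ : Fin n → Fin k} (K : KaleidoscopicalColoring α A k χ) where
  open Group G using (Carrier; _∙_; ε; _⁻¹)
  open Action α
  open KaleidoscopicalColoring K

  translate : Carrier → Fin n → Bool
  translate g y = lookup A (act (g ⁻¹) y)

  ∈translate⇒ : ∀ g y → _∈[_·_] α y g A → translate g y ≡ true
  ∈translate⇒ g y (a , a∈A , ga≡y) = begin
    lookup A (act (g ⁻¹) y)         ≡⟨ cong (lookup A ∘ act (g ⁻¹)) ga≡y ⟨
    lookup A (act (g ⁻¹) (act g a)) ≡⟨ cong (lookup A) (act-inverseˡ α g a) ⟩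
    lookup A a                      ≡⟨ []=⇒lookup a∈A ⟩
    true                            ∎

  translate⇒∈ : ∀ g y → translate g y ≡ true → _∈[_·_] α y g A
  translate⇒∈ g y gy≡true = act (g ⁻¹) y , lookup⇒[]= _ A gy≡true , act-inverseʳ α g y

  translate-balanced : ∀ g → Balanced χ (𝟙 ∘ translate g) 1
  translate-balanced g i with restr-surjective g i
  ... | y₀ , y₀∈gA , χy₀≡i =
    sum-unique _ y₀ (cong₂ _*_ (cong 𝟙 (dec-true (χ y₀ ≟ i) χy₀≡i)) (cong 𝟙 (∈translate⇒ g y₀ y₀∈gA)))
      others
    where
    others : ∀ y → y ≢ y₀ → 𝟙 (does (χ y ≟ i)) * 𝟙 (translate g y) ≡ 0
    others y y≢y₀ with χ y ≟ i | translate g y in gy≡b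
    ... | no _     | _     = refl
    ... | yes _    | false = refl
    ... | yes χy≡i | true  =
      ⊥-elim (y≢y₀ (restr-injective g y y₀ (translate⇒∈ g y gy≡b) y₀∈gA (trans χy≡i (sym χy₀≡i))))

  ∣A∣≡k : ∣ A ∣ ≡ k
  ∣A∣≡k = begin
    ∣ A ∣                                       ≡⟨ count≡sum (_≟ᵇ true) A ⟩
    sum (λ y → 𝟙 (does (lookup A y ≟ᵇ true)))  ≡⟨ sum-cong-≗ (λ y → 𝟙-does-≟true (lookup A y)) ⟩
    sum (𝟙 ∘ lookup A)                          ≡⟨ sum-cong-≗ (λ y → cong (𝟙 ∘ lookup A) (act-ε⁻¹ α y)) ⟨
    sum (𝟙 ∘ translate ε)                       ≡⟨ balanced⇒sum≡k*r χ _ (translate-balanced ε) ⟩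
    k * 1                                       ≡⟨ *-identityʳ k ⟩
    k                                           ∎
    where
    𝟙-does-≟true : ∀ b → 𝟙 (does (b ≟ᵇ true)) ≡ 𝟙 b
    𝟙-does-≟true false = refl
    𝟙-does-≟true true  = refl

  IsTranslate : Code n → Set c
  IsTranslate t = Σ Carrier λ g → decode t ≗ translate g

  isTranslate-shift : ∀ s {t} → IsTranslate t → IsTranslate (shift α s t)
  isTranslate-shift s {t} (g , t≗gA) = s ∙ g , λ y → begin
    decode (shift α s t) y                 ≡⟨ decode-shift α s t y ⟩
    decode t (act (s ⁻¹) y)                ≡⟨ t≗gA _ ⟩
    lookup A (act (g ⁻¹) (act (s ⁻¹) y))   ≡⟨ cong (lookup A) (act-⁻¹-∙ α s g y) ⟨
    translate (s ∙ g) y                    ∎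

  isTranslate-unshift : ∀ s {t} → IsTranslate (shift α s t) → IsTranslate t
  isTranslate-unshift s {t} = subst IsTranslate (shift⁻¹-shift α s t) ∘ isTranslate-shift (s ⁻¹)

  module Counting (transitive : Transitive α) (isTranslate? : ∀ t → Dec (IsTranslate t)) where

    weight : Code n → ℕ
    weight t = 𝟙 (does (isTranslate? t))

    weight-shift : ∀ s t → weight (shift α s t) ≡ weight t
    weight-shift s t = cong 𝟙 (does-⇔ (mk⇔ (isTranslate-unshift s) (isTranslate-shift s))
                                      (isTranslate? (shift α s t)) (isTranslate? t))

    incidence : Code n → Fin n → ℕ
    incidence t y = weight t * 𝟙 (decode t y)

    incidence-balanced : ∀ t → Balanced χ (incidence t) (weight t)
    incidence-balanced t i = begin
      sum (λ y → fibre χ i y * (weight t * 𝟙 (decode t y)))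
        ≡⟨ sum-cong-≗ (λ y → x∙yz≈y∙xz (fibre χ i y) (weight t) (𝟙 (decode t y))) ⟩
      sum (λ y → weight t * (fibre χ i y * 𝟙 (decode t y)))
        ≡⟨ *-distribˡ-sum (weight t) (λ y → fibre χ i y * 𝟙 (decode t y)) ⟨
      weight t * sum (λ y → fibre χ i y * 𝟙 (decode t y))
        ≡⟨ 𝟙*≡𝟙 (isTranslate? t) translateMeetsFibreOnce ⟩
      weight t
        ∎
      where
      translateMeetsFibreOnce : IsTranslate t → sum (λ y → fibre χ i y * 𝟙 (decode t y)) ≡ 1
      translateMeetsFibreOnce (g , t≗gA) =
        trans (sum-cong-≗ λ y → cong (λ b → fibre χ i y * 𝟙 b) (t≗gA y)) (translate-balanced g i)

    multiplicity : Fin n → ℕ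
    multiplicity y = sum (λ t → incidence t y)

    multiplicity-act : ∀ s x → multiplicity (act s x) ≡ multiplicity x
    multiplicity-act s x = begin
      sum (λ t → incidence t (act s x))            ≡⟨ ∑-permute _ (shift-permutation α s) ⟩
      sum (λ t → incidence (shift α s t) (act s x)) ≡⟨ sum-cong-≗ (λ t → cong₂ _*_ (weight-shift s t)
                                                         (cong 𝟙 (decode-shift-act t))) ⟩
      multiplicity x                               ∎
      where
      decode-shift-act : ∀ t → decode (shift α s t) (act s x) ≡ decode t x
      decode-shift-act t = trans (decode-shift α s t _) (cong (decode t) (act-inverseˡ α s x))

    multiplicity-constant : ∀ x y → multiplicity y ≡ multiplicity x
    multiplicity-constant x y with transitive x y
    ... | s , refl = multiplicity-act s x

    multiplicity-positive : ∀ {a} → a ∈ A → 0 < multiplicity a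
    multiplicity-positive {a} a∈A = subst (_≤ multiplicity a) incidence≡1 (≤-sum _ (encode (translate ε)))
      where
      incidence≡1 : incidence (encode (translate ε)) a ≡ 1
      incidence≡1 = cong₂ _*_ (cong 𝟙 (dec-true (isTranslate? _) (ε , decode-encode _)))
                              (cong 𝟙 (trans (decode-encode _ a) (∈translate⇒ ε a (a , a∈A , act-ε a))))

    n≡k*fiberSize : ∀ i → n ≡ k * fiberSize χ i
    n≡k*fiberSize i with restr-surjective ε i
    ... | _ , (a , a∈A , _) , _ =
      uniformCover⇒n≡k*fiberSize χ incidence weight incidence-balanced
        (multiplicity a) {{>-nonZero (multiplicity-positive a∈A)}} (λ y → multiplicity-constant a y) i

  n≡k*fiberSize : Transitive α → ∀ i → n ≡ k * fiberSize χ i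
  n≡k*fiberSize transitive i = decidable-stable (n ≟ℕ k * fiberSize χ i) λ n≢k*fiberSize →
    ¬¬-Decidable IsTranslate λ isTranslate? →
      n≢k*fiberSize (Counting.n≡k*fiberSize transitive isTranslate? i)

corollary1p8 : {c ℓ : Level} (G : Group c ℓ) (n : ℕ) (α : Action G n) →
    Transitive α →
    (A : Subset n) (k : ℕ) (χ : Fin n → Fin k) →
    KaleidoscopicalColoring α A k χ →
    (∀ i j → fiberSize χ i ≡ fiberSize χ j) × (∀ i → n ≡ ∣ A ∣ * fiberSize χ i)
corollary1p8 G n α transitive A k χ K =
  (λ i j → *-cancelˡ-≡ _ _ k {{nonZeroIndex i}}
             (trans (sym (n≡k*fiberSize transitive i)) (n≡k*fiberSize transitive j))) ,
  (λ i → trans (n≡k*fiberSize transitive i) (cong (_* fiberSize χ i) (sym ∣A∣≡k)))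
  where open Kaleidoscopic α K
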